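{- Let $n>1$ be an integer and let $G$ be a finite group having subgroups $A$, $B$, $M$ such that (1) $|A|=|B|=|M|=nk$ and $|G|=n^3k$, where $k=|A\cap B|$; (2) $AM$ and $BM$ are subgroups of $G$ of order $n^2k$; (3) $G=AMB$; (4) $AB\cap BA=A\cup B$. Then: (i) $A\cap M=A\cap B=B\cap M$; (ii) $AM\cap B=A\cap B=BM\cap A$; (iii) $AM\cap BM=M$; (iv) $AM=G\setminus\big(A(B\setminus A)A\big)$ and $BM=G\setminus\big(B(A\setminus B)B\big)$; (v) $G=ABAB=\langle A,B\rangle$; (vi) $A$ and $B$ uniquely determine $M$: if $M'$ is a subgroup of $G$ such that $A,B,M'$ also satisfy (1)–(4), then $M'=M$.
   Context: For subsets $X,Y$ of $G$, $XY=\{xy\mid x\in X, y\in Y\}$, and similarly for products of more subsets; $ABAB$ denotes the set of all products $a_1b_1a_2b_2$ with $a_i\in A$, $b_i\in B$. -}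

module Defs where

open import Data.Nat using (ℕ)
open import Data.Bool using (Bool; true; false; _∧_)
open import Data.Fin using (Fin)
open import Data.Fin.Properties using (_≟_)
open import Data.Fin.Subset using (Subset; _∈_; _⊆_; ⊤)
open import Data.Bool.ListAction using (any)
open import Data.List.Base using (allFin)
open import Data.Vec using (lookup; tabulate)
open import Data.Product using (_×_)
open import Relation.Nullary.Decidable using (⌊_⌋)
open import Relation.Binary.PropositionalEquality using (_≡_)
open import Algebra.Structures using (IsGroup)

-- A finite group of order N, with carrier Fin N (every finite group of
-- order N is isomorphic to one of this form).
record FinGroup (N : ℕ) : Set where
  field
    _∙_     : Fin N → Fin N → Fin N
    e       : Fin N
    inv     : Fin N → Fin N
    isGroup : IsGroup _≡_ _∙_ e inv

module _ {N : ℕ} (G : FinGroup N) where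
  open FinGroup G

  prod : Subset N → Subset N → Subset N
  prod X Y = tabulate λ g →
    any (λ a → any (λ b → lookup X a ∧ lookup Y b ∧ ⌊ a ∙ b ≟ g ⌋) (allFin N)) (allFin N)

  IsSubgroup : Subset N → Set
  IsSubgroup H = (e ∈ H)
               × (∀ x y → x ∈ H → y ∈ H → (x ∙ y) ∈ H)
               × (∀ x → x ∈ H → inv x ∈ H)

  GeneratedBy : Subset N → Subset N → Set
  GeneratedBy A B = ∀ H → IsSubgroup H → A ⊆ H → B ⊆ H → H ≡ ⊤

module Submission where

-- Counting the fibres of the multiplication map X × Y → XY gives |XY| |X ∩ Y| = |X| |Y| for
-- subgroups X, Y. Applied to AM·B = G, BM·A = G (its inverse) and AM·BM = G this yields
-- |AM ∩ B| = |BM ∩ A| = k and |AM ∩ BM| = nk, whence (i)–(iii). For (iv), AM misses A(B∖A)A since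
-- AM ∩ B = A ∩ B; a second fibre count, where (4) makes the fibres of A(B∖A) × A → A(B∖A)A cosets
-- of A ∩ B, gives |A(B∖A)A| = n²|B∖A| = n²(nk − k), so its complement has the order n²k of AM.
-- For (v), g ∉ BM lies in B(A∖B)B and g ∉ AM in A(B∖A)A, while g ∈ AM ∩ BM = M is a (a⁻¹g) with
-- a ∈ A∖M, where a⁻¹g ∉ BM. By (iii) and (iv), M = AM ∩ BM is determined by A and B, which is (vi).

open import Defs
open import Algebra.Bundles using (Group)
open import Algebra.Structures using (IsGroup)
open import Data.Bool using (Bool; true; false; _∧_; T; if_then_else_)
open import Data.Bool.Properties using (T-≡; T-∧)
open import Data.Bool.ListAction using (any)
open import Data.Empty using (⊥-elim)
open import Data.Fin using (Fin)
open import Data.Fin.Permutation using (permutation)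
open import Data.Fin.Properties using (_≟_)
open import Data.Fin.Subset
  using (Subset; ⊤; ⊥; ∁; _∩_; _∪_; _─_; ∣_∣; _∈_; _∉_; _⊆_; Nonempty)
open import Data.Fin.Subset.Properties
  using ( _∈?_; ⊆-antisym; ⊆⊤; ∈⊤; ∣⊤∣≡n; ∣⊥∣≡0; ∣p∣≤n; ∣∁p∣≡n∸∣p∣; p⊆q⇒∣p∣≤∣q∣; drop-∷-⊆
        ; Empty-unique; nonempty?; x∈p⇒∣p-x∣<∣p∣; x∈p∩q⁺; x∈p∩q⁻; x∈p∪q⁻
        ; x∈p∧x∉q⇒x∈p─q; p─q⊆p; x∉p⇒x∈∁p; x∉∁p⇒x∈p; ∩-comm; ∪-comm)
open import Data.List.Base using (allFin)
open import Data.List.Membership.Propositional using (lose)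
open import Data.List.Membership.Propositional.Properties using (∈-allFin)
open import Data.List.Relation.Unary.Any using (satisfied)
open import Data.List.Relation.Unary.Any.Properties using (any⁺; any⁻)
open import Data.Nat using (ℕ; suc; s≤s; _+_; _*_; _^_; _≤_; _<_; _>_; NonZero; >-nonZero)
open import Data.Nat.Properties
  using ( *-zeroʳ; *-comm; *-cancelˡ-≡; *-cancelʳ-≡; +-cancelʳ-≡; +-identityʳ; +-suc; m∸n+n≡m; ≤-trans; ≤-reflexive
        ; m*n≢0; m^n≢0; m<n⇒0<n; m<m*n; <-irrefl; +-*-semiring)
open import Data.Nat.Solver using (module +-*-Solver)
open import Data.Product using (_×_; _,_; proj₁; proj₂; ∃₂)
open import Data.Sum using (inj₁; inj₂)
open import Data.Vec using (_∷_; []; lookup; here; there)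
open import Data.Vec.Properties using (lookup∘tabulate; []=⇒lookup; lookup⇒[]=)
open import Function using (_∘_; id; _⇔_; mk⇔; Equivalence)
open import Relation.Binary.PropositionalEquality
open import Relation.Nullary using (yes; no)
open import Relation.Nullary.Decidable using (⌊_⌋; toWitness; fromWitness)
open import Algebra.Properties.Semiring.Sum +-*-semiring
  using (sum; sum-cong-≗; sum-replicate-zero; ∑-comm; ∑-permute; *-distribˡ-sum; *-distribʳ-sum)
import Algebra.Properties.Group as GroupProperties

open Equivalence using (to; from)

private
  variable
    n : ℕ
    p q r : Subset n
    x y z : Fin n

χ : Subset n → Fin n → ℕ
χ p x = if lookup p x then 1 else 0

∣p∣≡∑χ : (p : Subset n) → ∣ p ∣ ≡ sum (χ p)
∣p∣≡∑χ []          = refl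
∣p∣≡∑χ (true ∷ p)  = cong suc (∣p∣≡∑χ p)
∣p∣≡∑χ (false ∷ p) = ∣p∣≡∑χ p

x∈p⇒χ≡1 : x ∈ p → χ p x ≡ 1
x∈p⇒χ≡1 x∈p rewrite []=⇒lookup x∈p = refl

x∉p⇒χ≡0 : x ∉ p → χ p x ≡ 0
x∉p⇒χ≡0 {x = x} {p = p} x∉p with lookup p x in eq
... | true  = ⊥-elim (x∉p (lookup⇒[]= x p eq))
... | false = refl

χ*χ≡χ : ((x ∈ p × y ∈ q) ⇔ z ∈ r) → χ p x * χ q y ≡ χ r z
χ*χ≡χ {x = x} {p = p} {y = y} {q = q} {z = z} {r = r} iff with x ∈? p | y ∈? q
... | yes x∈p | yes y∈q =
  trans (cong₂ _*_ (x∈p⇒χ≡1 x∈p) (x∈p⇒χ≡1 y∈q)) (sym (x∈p⇒χ≡1 (to iff (x∈p , y∈q))))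
... | no x∉p  | _       =
  trans (cong (_* χ q y) (x∉p⇒χ≡0 x∉p)) (sym (x∉p⇒χ≡0 (x∉p ∘ proj₁ ∘ from iff)))
... | yes _   | no y∉q  =
  trans (trans (cong (χ p x *_) (x∉p⇒χ≡0 y∉q)) (*-zeroʳ (χ p x)))
        (sym (x∉p⇒χ≡0 (y∉q ∘ proj₂ ∘ from iff)))

x∈p─q⇒x∉q : x ∈ p ─ q → x ∉ q
x∈p─q⇒x∉q {p = _ ∷ p} {q = true  ∷ q} (there x∈p─q) (there x∈q) = x∈p─q⇒x∉q x∈p─q x∈q
x∈p─q⇒x∉q {p = _ ∷ p} {q = false ∷ q} (there x∈p─q) (there x∈q) = x∈p─q⇒x∉q x∈p─q x∈q

∣p─q∣+∣p∩q∣≡∣p∣ : (p q : Subset n) → ∣ p ─ q ∣ + ∣ p ∩ q ∣ ≡ ∣ p ∣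
∣p─q∣+∣p∩q∣≡∣p∣ []          []          = refl
∣p─q∣+∣p∩q∣≡∣p∣ (true ∷ p)  (true ∷ q)  = trans (+-suc _ _) (cong suc (∣p─q∣+∣p∩q∣≡∣p∣ p q))
∣p─q∣+∣p∩q∣≡∣p∣ (true ∷ p)  (false ∷ q) = cong suc (∣p─q∣+∣p∩q∣≡∣p∣ p q)
∣p─q∣+∣p∩q∣≡∣p∣ (false ∷ p) (true ∷ q)  = ∣p─q∣+∣p∩q∣≡∣p∣ p q
∣p─q∣+∣p∩q∣≡∣p∣ (false ∷ p) (false ∷ q) = ∣p─q∣+∣p∩q∣≡∣p∣ p q

p⊆q∧∣q∣≤∣p∣⇒p≡q : (p q : Subset n) → p ⊆ q → ∣ q ∣ ≤ ∣ p ∣ → p ≡ q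
p⊆q∧∣q∣≤∣p∣⇒p≡q []          []          _   _         = refl
p⊆q∧∣q∣≤∣p∣⇒p≡q (true ∷ p)  (true ∷ q)  p⊆q (s≤s q≤p) = cong (true ∷_) (p⊆q∧∣q∣≤∣p∣⇒p≡q p q (drop-∷-⊆ p⊆q) q≤p)
p⊆q∧∣q∣≤∣p∣⇒p≡q (false ∷ p) (false ∷ q) p⊆q q≤p       = cong (false ∷_) (p⊆q∧∣q∣≤∣p∣⇒p≡q p q (drop-∷-⊆ p⊆q) q≤p)
p⊆q∧∣q∣≤∣p∣⇒p≡q (true ∷ p)  (false ∷ q) p⊆q _         with p⊆q here
... | ()
p⊆q∧∣q∣≤∣p∣⇒p≡q (false ∷ p) (true ∷ q)  p⊆q q≤p       =
  ⊥-elim (<-irrefl refl (≤-trans q≤p (p⊆q⇒∣p∣≤∣q∣ (drop-∷-⊆ p⊆q))))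

∣∁p∣+∣p∣≡n : (p : Subset n) → ∣ ∁ p ∣ + ∣ p ∣ ≡ n
∣∁p∣+∣p∣≡n p = trans (cong (_+ ∣ p ∣) (∣∁p∣≡n∸∣p∣ p)) (m∸n+n≡m (∣p∣≤n p))

x∈p⇒∣p∣≢0 : x ∈ p → NonZero ∣ p ∣
x∈p⇒∣p∣≢0 x∈p = >-nonZero (m<n⇒0<n (x∈p⇒∣p-x∣<∣p∣ x∈p))

∣p∩q∣<∣p∣⇒Nonempty[p─q] : ∀ {n} {p q : Subset n} → ∣ p ∩ q ∣ < ∣ p ∣ → Nonempty (p ─ q)
∣p∩q∣<∣p∣⇒Nonempty[p─q] {n = n} {p = p} {q = q} ∣p∩q∣<∣p∣ with nonempty? (p ─ q)
... | yes ne   = ne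
... | no empty = ⊥-elim (<-irrefl ∣p∩q∣≡∣p∣ ∣p∩q∣<∣p∣)
  where
  ∣p∩q∣≡∣p∣ : ∣ p ∩ q ∣ ≡ ∣ p ∣
  ∣p∩q∣≡∣p∣ = begin
    ∣ p ∩ q ∣               ≡⟨ cong (_+ ∣ p ∩ q ∣) (∣⊥∣≡0 n) ⟨
    ∣ ⊥ {n} ∣ + ∣ p ∩ q ∣   ≡⟨ cong (λ s → ∣ s ∣ + ∣ p ∩ q ∣) (Empty-unique empty) ⟨
    ∣ p ─ q ∣ + ∣ p ∩ q ∣   ≡⟨ ∣p─q∣+∣p∩q∣≡∣p∣ p q ⟩
    ∣ p ∣                   ∎
    where open ≡-Reasoning

all∈⇒≡⊤ : (∀ x → x ∈ p) → p ≡ ⊤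
all∈⇒≡⊤ all∈ = ⊆-antisym ⊆⊤ (λ {x} _ → all∈ x)

module _ {N : ℕ} (G : FinGroup N) where

  open FinGroup G
  open IsGroup isGroup using (assoc; identityˡ; identityʳ)

  private
    group : Group _ _
    group = record { isGroup = isGroup }

    variable
      a b g t : Fin N
      A B H K M W X X′ Y Y′ Z : Subset N

  open GroupProperties group
    using (⁻¹-anti-homo-∙; ⁻¹-involutive; \\-leftDividesˡ; \\-leftDividesʳ; //-rightDividesʳ)

  module Subgroup (H≤G : IsSubgroup G H) where

    e∈ : e ∈ H
    e∈ = proj₁ H≤G

    ∙-closed : a ∈ H → b ∈ H → a ∙ b ∈ H
    ∙-closed = proj₁ (proj₂ H≤G) _ _

    inv-closed : a ∈ H → inv a ∈ H
    inv-closed = proj₂ (proj₂ H≤G) _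

    ∈-cancelˡ : a ∈ H → a ∙ t ∈ H → t ∈ H
    ∈-cancelˡ {a} {t} a∈H at∈H = subst (_∈ H) (\\-leftDividesʳ a t) (∙-closed (inv-closed a∈H) at∈H)

    ∈-cancelʳ : t ∈ H → a ∙ t ∈ H → a ∈ H
    ∈-cancelʳ {t} {a} t∈H at∈H = subst (_∈ H) (//-rightDividesʳ t a) (∙-closed at∈H (inv-closed t∈H))

    inv-∈⇒∈ : inv a ∈ H → a ∈ H
    inv-∈⇒∈ {a} a⁻¹∈H = subst (_∈ H) (⁻¹-involutive a) (inv-closed a⁻¹∈H)

  open Subgroup

  private
    entry : Subset N → Subset N → Fin N → Fin N → Fin N → Bool
    entry X Y g a b = lookup X a ∧ lookup Y b ∧ ⌊ a ∙ b ≟ g ⌋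

    ∈⇔T : a ∈ X ⇔ T (lookup X a)
    ∈⇔T {a} {X} = mk⇔ (from T-≡ ∘ []=⇒lookup) (lookup⇒[]= a X ∘ to T-≡)

    T-entry : T (entry X Y g a b) ⇔ (a ∈ X × b ∈ Y × a ∙ b ≡ g)
    T-entry {X} {Y} {g} {a} {b} = mk⇔ split join
      where
      split : T (entry X Y g a b) → a ∈ X × b ∈ Y × a ∙ b ≡ g
      split t with to T-∧ t
      ... | ta , tr with to (T-∧ {lookup Y b}) tr
      ... | tb , tc = from ∈⇔T ta , from ∈⇔T tb , toWitness tc
      join : a ∈ X × b ∈ Y × a ∙ b ≡ g → T (entry X Y g a b)
      join (a∈X , b∈Y , refl) = from T-∧ (to ∈⇔T a∈X , from T-∧ (to ∈⇔T b∈Y , fromWitness refl))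

    row : Subset N → Subset N → Fin N → Fin N → Bool
    row X Y g a = any (entry X Y g a) (allFin N)

    ∈prod⇔T : g ∈ prod G X Y ⇔ T (any (row X Y g) (allFin N))
    ∈prod⇔T {g} {X} {Y} = subst (λ β → g ∈ prod G X Y ⇔ T β) (lookup∘tabulate _ g) ∈⇔T

  ∈-prod⁺ : a ∈ X → b ∈ Y → a ∙ b ∈ prod G X Y
  ∈-prod⁺ {a} {X} {b} {Y} a∈X b∈Y = from (∈prod⇔T {X = X} {Y})
    (any⁺ (row X Y (a ∙ b)) (lose (∈-allFin a)
      (any⁺ (entry X Y (a ∙ b) a) (lose (∈-allFin b) (from (T-entry {X} {Y}) (a∈X , b∈Y , refl))))))

  ∈-prod⁻ : ∀ X Y → g ∈ prod G X Y → ∃₂ λ a b → a ∈ X × b ∈ Y × a ∙ b ≡ g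
  ∈-prod⁻ {g} X Y g∈XY with satisfied (any⁻ (row X Y g) (allFin N) (to (∈prod⇔T {X = X} {Y}) g∈XY))
  ... | a , ta with satisfied (any⁻ (entry X Y g a) (allFin N) ta)
  ... | b , tab = a , b , to (T-entry {X} {Y}) tab

  prod-mono : X ⊆ X′ → Y ⊆ Y′ → prod G X Y ⊆ prod G X′ Y′
  prod-mono {X} {Y = Y} X⊆X′ Y⊆Y′ g∈XY with ∈-prod⁻ X Y g∈XY
  ... | a , b , a∈X , b∈Y , refl = ∈-prod⁺ (X⊆X′ a∈X) (Y⊆Y′ b∈Y)

  ⊆-prodˡ : e ∈ Y → X ⊆ prod G X Y
  ⊆-prodˡ {Y} {X} e∈Y {a} a∈X = subst (_∈ prod G X Y) (identityʳ a) (∈-prod⁺ a∈X e∈Y)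

  ⊆-prodʳ : e ∈ X → Y ⊆ prod G X Y
  ⊆-prodʳ {X} {Y} e∈X {b} b∈Y = subst (_∈ prod G X Y) (identityˡ b) (∈-prod⁺ e∈X b∈Y)

  prod-⊆-subgroup : IsSubgroup G H → X ⊆ H → Y ⊆ H → prod G X Y ⊆ H
  prod-⊆-subgroup {X = X} {Y = Y} H≤G X⊆H Y⊆H g∈XY with ∈-prod⁻ X Y g∈XY
  ... | a , b , a∈X , b∈Y , refl = ∙-closed H≤G (X⊆H a∈X) (Y⊆H b∈Y)

  inv-∈-prod₃ : IsSubgroup G X → IsSubgroup G Y → IsSubgroup G Z
    → g ∈ prod G (prod G X Y) Z → inv g ∈ prod G (prod G Z Y) X
  inv-∈-prod₃ {X = X} {Y = Y} {Z = Z} X≤G Y≤G Z≤G g∈XYZ with ∈-prod⁻ (prod G X Y) Z g∈XYZ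
  ... | xy , c , xy∈XY , c∈Z , refl with ∈-prod⁻ X Y xy∈XY
  ... | a , b , a∈X , b∈Y , refl = subst (_∈ prod G (prod G Z Y) X) inv-abc
    (∈-prod⁺ (∈-prod⁺ (inv-closed Z≤G c∈Z) (inv-closed Y≤G b∈Y)) (inv-closed X≤G a∈X))
    where
    inv-abc : (inv c ∙ inv b) ∙ inv a ≡ inv ((a ∙ b) ∙ c)
    inv-abc = begin
      (inv c ∙ inv b) ∙ inv a   ≡⟨ assoc (inv c) (inv b) (inv a) ⟩
      inv c ∙ (inv b ∙ inv a)   ≡⟨ cong (inv c ∙_) (⁻¹-anti-homo-∙ a b) ⟨
      inv c ∙ inv (a ∙ b)       ≡⟨ ⁻¹-anti-homo-∙ (a ∙ b) c ⟨
      inv ((a ∙ b) ∙ c)         ∎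
      where open ≡-Reasoning

  XYZ≡⊤⇒ZYX≡⊤ : IsSubgroup G X → IsSubgroup G Y → IsSubgroup G Z
    → prod G (prod G X Y) Z ≡ ⊤ → prod G (prod G Z Y) X ≡ ⊤
  XYZ≡⊤⇒ZYX≡⊤ X≤G Y≤G Z≤G XYZ≡⊤ = all∈⇒≡⊤ λ g →
    subst (_∈ _) (⁻¹-involutive g)
      (inv-∈-prod₃ X≤G Y≤G Z≤G (subst (inv g ∈_) (sym XYZ≡⊤) ∈⊤))

  ∑-translateˡ : ∀ h (f : Fin N → ℕ) → sum f ≡ sum (λ g → f (h ∙ g))
  ∑-translateˡ h f = ∑-permute f (permutation (h ∙_) (inv h ∙_) (\\-leftDividesˡ h) (\\-leftDividesʳ h))

  -- The pairs (x, y) ∈ X × Y with x y = a b are the pairs (a t, t⁻¹ b); this says they are indexed by Z.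
  FibresIndexedBy : Subset N → Subset N → Subset N → Set
  FibresIndexedBy X Y Z = ∀ {a b t} → a ∈ X → b ∈ Y → (a ∙ t ∈ X × inv t ∙ b ∈ Y) ⇔ t ∈ Z

  fibre-sum : (X Y Z : Subset N) → FibresIndexedBy X Y Z
    → ∀ g → sum (λ a → χ X a * χ Y (inv a ∙ g)) ≡ χ (prod G X Y) g * ∣ Z ∣
  fibre-sum X Y Z fibres g with g ∈? prod G X Y
  ... | no g∉XY = begin
    sum (λ a → χ X a * χ Y (inv a ∙ g))  ≡⟨ sum-cong-≗ term≡0 ⟩
    sum {N} (λ _ → 0)                    ≡⟨ sum-replicate-zero N ⟩
    0                                    ≡⟨ cong (_* ∣ Z ∣) (x∉p⇒χ≡0 g∉XY) ⟨
    χ (prod G X Y) g * ∣ Z ∣             ∎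
    where
    open ≡-Reasoning
    term≡0 : ∀ a → χ X a * χ Y (inv a ∙ g) ≡ 0
    term≡0 a = trans (χ*χ≡χ {p = X} {q = Y} {r = prod G X Y} (mk⇔
      (λ (a∈X , a⁻¹g∈Y) → subst (_∈ prod G X Y) (\\-leftDividesˡ a g) (∈-prod⁺ a∈X a⁻¹g∈Y))
      (λ g∈XY → ⊥-elim (g∉XY g∈XY)))) (x∉p⇒χ≡0 g∉XY)
  ... | yes g∈XY with ∈-prod⁻ X Y g∈XY
  ... | a , b , a∈X , b∈Y , refl = begin
    sum (λ c → χ X c * χ Y (inv c ∙ (a ∙ b)))              ≡⟨ ∑-translateˡ a _ ⟩
    sum (λ t → χ X (a ∙ t) * χ Y (inv (a ∙ t) ∙ (a ∙ b)))  ≡⟨ sum-cong-≗ (λ t → cong (λ u → χ X (a ∙ t) * χ Y u) (cancel t)) ⟩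
    sum (λ t → χ X (a ∙ t) * χ Y (inv t ∙ b))              ≡⟨ sum-cong-≗ (λ t → χ*χ≡χ {p = X} {q = Y} (fibres {t = t} a∈X b∈Y)) ⟩
    sum (χ Z)                                              ≡⟨ ∣p∣≡∑χ Z ⟨
    ∣ Z ∣                                                  ≡⟨ +-identityʳ ∣ Z ∣ ⟨
    1 * ∣ Z ∣                                              ≡⟨ cong (_* ∣ Z ∣) (x∈p⇒χ≡1 g∈XY) ⟨
    χ (prod G X Y) (a ∙ b) * ∣ Z ∣                         ∎
    where
    open ≡-Reasoning
    cancel : ∀ t → inv (a ∙ t) ∙ (a ∙ b) ≡ inv t ∙ b
    cancel t = begin
      inv (a ∙ t) ∙ (a ∙ b)        ≡⟨ cong (_∙ (a ∙ b)) (⁻¹-anti-homo-∙ a t) ⟩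
      (inv t ∙ inv a) ∙ (a ∙ b)    ≡⟨ assoc (inv t) (inv a) (a ∙ b) ⟩
      inv t ∙ (inv a ∙ (a ∙ b))    ≡⟨ cong (inv t ∙_) (\\-leftDividesʳ a b) ⟩
      inv t ∙ b                    ∎

  fibre-counting : (X Y Z : Subset N) → FibresIndexedBy X Y Z → ∣ prod G X Y ∣ * ∣ Z ∣ ≡ ∣ X ∣ * ∣ Y ∣
  fibre-counting X Y Z fibres = sym (begin
    ∣ X ∣ * ∣ Y ∣                                    ≡⟨ cong₂ _*_ (∣p∣≡∑χ X) (∣p∣≡∑χ Y) ⟩
    sum (χ X) * sum (χ Y)                            ≡⟨ *-distribʳ-sum (sum (χ Y)) (χ X) ⟩
    sum (λ a → χ X a * sum (χ Y))                    ≡⟨ sum-cong-≗ (λ a → cong (χ X a *_) (∑-translateˡ (inv a) (χ Y))) ⟩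
    sum (λ a → χ X a * sum (λ g → χ Y (inv a ∙ g)))  ≡⟨ sum-cong-≗ (λ a → *-distribˡ-sum (χ X a) (λ g → χ Y (inv a ∙ g))) ⟩
    sum (λ a → sum (λ g → χ X a * χ Y (inv a ∙ g)))  ≡⟨ ∑-comm (λ a g → χ X a * χ Y (inv a ∙ g)) ⟩
    sum (λ g → sum (λ a → χ X a * χ Y (inv a ∙ g)))  ≡⟨ sum-cong-≗ (fibre-sum X Y Z fibres) ⟩
    sum (λ g → χ XY g * ∣ Z ∣)                       ≡⟨ *-distribʳ-sum ∣ Z ∣ (χ XY) ⟨
    sum (χ XY) * ∣ Z ∣                               ≡⟨ cong (_* ∣ Z ∣) (∣p∣≡∑χ XY) ⟨
    ∣ XY ∣ * ∣ Z ∣                                   ∎)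
    where
    open ≡-Reasoning
    XY = prod G X Y

  product-formula : IsSubgroup G X → IsSubgroup G Y → ∣ prod G X Y ∣ * ∣ X ∩ Y ∣ ≡ ∣ X ∣ * ∣ Y ∣
  product-formula {X} {Y} X≤G Y≤G = fibre-counting X Y (X ∩ Y) λ a∈X b∈Y → mk⇔
    (λ (at∈X , t⁻¹b∈Y) → x∈p∩q⁺ (∈-cancelˡ X≤G a∈X at∈X , inv-∈⇒∈ Y≤G (∈-cancelʳ Y≤G b∈Y t⁻¹b∈Y)))
    (λ t∈X∩Y → let (t∈X , t∈Y) = x∈p∩q⁻ X Y t∈X∩Y in
      ∙-closed X≤G a∈X t∈X , ∙-closed Y≤G (inv-closed Y≤G t∈Y) b∈Y)

  XY≡⊤⇒N*∣X∩Y∣≡∣X∣*∣Y∣ : IsSubgroup G X → IsSubgroup G Y → prod G X Y ≡ ⊤ → N * ∣ X ∩ Y ∣ ≡ ∣ X ∣ * ∣ Y ∣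
  XY≡⊤⇒N*∣X∩Y∣≡∣X∣*∣Y∣ {X} {Y} X≤G Y≤G XY≡⊤ = begin
    N * ∣ X ∩ Y ∣              ≡⟨ cong (_* ∣ X ∩ Y ∣) (∣⊤∣≡n N) ⟨
    ∣ ⊤ {N} ∣ * ∣ X ∩ Y ∣      ≡⟨ cong (λ P → ∣ P ∣ * ∣ X ∩ Y ∣) XY≡⊤ ⟨
    ∣ prod G X Y ∣ * ∣ X ∩ Y ∣  ≡⟨ product-formula X≤G Y≤G ⟩
    ∣ X ∣ * ∣ Y ∣              ∎
    where open ≡-Reasoning

  ∩-subgroup : IsSubgroup G X → IsSubgroup G Y → IsSubgroup G (X ∩ Y)
  ∩-subgroup {X} {Y} X≤G Y≤G =
    x∈p∩q⁺ (e∈ X≤G , e∈ Y≤G) ,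
    (λ a b a∈X∩Y b∈X∩Y → let (a∈X , a∈Y) = x∈p∩q⁻ X Y a∈X∩Y ; (b∈X , b∈Y) = x∈p∩q⁻ X Y b∈X∩Y in
      x∈p∩q⁺ (∙-closed X≤G a∈X b∈X , ∙-closed Y≤G a∈Y b∈Y)) ,
    (λ a a∈X∩Y → let (a∈X , a∈Y) = x∈p∩q⁻ X Y a∈X∩Y in x∈p∩q⁺ (inv-closed X≤G a∈X , inv-closed Y≤G a∈Y))

  ∈-prod-translateˡ : IsSubgroup G X → a ∈ X → g ∈ prod G X Y → a ∙ g ∈ prod G X Y
  ∈-prod-translateˡ {X} {a} {Y = Y} X≤G a∈X g∈XY with ∈-prod⁻ X Y g∈XY
  ... | x , y , x∈X , y∈Y , refl =
    subst (_∈ prod G X Y) (assoc a x y) (∈-prod⁺ (∙-closed X≤G a∈X x∈X) y∈Y)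

  module DoubleCosets (X≤G : IsSubgroup G X) (Y≤G : IsSubgroup G Y) where

    private
      D = Y ─ X
      XD = prod G X D

      d∈Y : b ∈ D → b ∈ Y
      d∈Y = p─q⊆p Y X

    ∙-∈─ʳ : b ∈ Y ─ X → t ∈ X ∩ Y → b ∙ t ∈ Y ─ X
    ∙-∈─ʳ b∈D t∈X∩Y = let (t∈X , t∈Y) = x∈p∩q⁻ X Y t∈X∩Y in
      x∈p∧x∉q⇒x∈p─q (∙-closed Y≤G (d∈Y b∈D) t∈Y) (x∈p─q⇒x∉q b∈D ∘ ∈-cancelʳ X≤G t∈X)

    ∙-∈─ˡ : b ∈ Y ─ X → t ∈ X ∩ Y → t ∙ b ∈ Y ─ X
    ∙-∈─ˡ b∈D t∈X∩Y = let (t∈X , t∈Y) = x∈p∩q⁻ X Y t∈X∩Y in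
      x∈p∧x∉q⇒x∈p─q (∙-closed Y≤G t∈Y (d∈Y b∈D)) (x∈p─q⇒x∉q b∈D ∘ ∈-cancelˡ X≤G t∈X)

    ∣X[Y─X]∣*∣X∩Y∣≡∣X∣*∣Y─X∣ : ∣ prod G X (Y ─ X) ∣ * ∣ X ∩ Y ∣ ≡ ∣ X ∣ * ∣ Y ─ X ∣
    ∣X[Y─X]∣*∣X∩Y∣≡∣X∣*∣Y─X∣ = fibre-counting X D (X ∩ Y) λ a∈X b∈D → mk⇔
      (λ (at∈X , t⁻¹b∈D) → x∈p∩q⁺ (∈-cancelˡ X≤G a∈X at∈X , inv-∈⇒∈ Y≤G (∈-cancelʳ Y≤G (d∈Y b∈D) (d∈Y t⁻¹b∈D))))
      (λ t∈X∩Y → ∙-closed X≤G a∈X (proj₁ (x∈p∩q⁻ X Y t∈X∩Y)) ,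
                 ∙-∈─ˡ b∈D (inv-closed (∩-subgroup X≤G Y≤G) t∈X∩Y))

    module _ (XY∩YX⊆X∪Y : prod G X Y ∩ prod G Y X ⊆ X ∪ Y) where

      private
        -- b t lies in XY ∩ YX, hence in X ∪ Y, and not in X because b ∉ X.
        bt∈XD⇒t∈Y : b ∈ D → t ∈ X → b ∙ t ∈ XD → t ∈ Y
        bt∈XD⇒t∈Y {b} {t} b∈D t∈X bt∈XD
          with x∈p∪q⁻ X Y (XY∩YX⊆X∪Y (x∈p∩q⁺ (prod-mono {X = X} {Y = D} id d∈Y bt∈XD , ∈-prod⁺ (d∈Y b∈D) t∈X)))
        ... | inj₁ bt∈X = ⊥-elim (x∈p─q⇒x∉q b∈D (∈-cancelʳ X≤G t∈X bt∈X))
        ... | inj₂ bt∈Y = ∈-cancelˡ Y≤G (d∈Y b∈D) bt∈Y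

        gt∈XD⇒t∈Y : g ∈ XD → t ∈ X → g ∙ t ∈ XD → t ∈ Y
        gt∈XD⇒t∈Y {t = t} g∈XD t∈X gt∈XD with ∈-prod⁻ X D g∈XD
        ... | a , d , a∈X , d∈D , refl = bt∈XD⇒t∈Y d∈D t∈X
          (subst (_∈ XD) (trans (cong (inv a ∙_) (assoc a d t)) (\\-leftDividesʳ a (d ∙ t)))
                 (∈-prod-translateˡ {Y = D} X≤G (inv-closed X≤G a∈X) gt∈XD))

        t∈X∩Y⇒gt∈XD : g ∈ XD → t ∈ X ∩ Y → g ∙ t ∈ XD
        t∈X∩Y⇒gt∈XD {t = t} g∈XD t∈X∩Y with ∈-prod⁻ X D g∈XD
        ... | a , d , a∈X , d∈D , refl =
          subst (_∈ XD) (sym (assoc a d t)) (∈-prod⁺ a∈X (∙-∈─ʳ d∈D t∈X∩Y))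

      ∣X[Y─X]X∣*∣X∩Y∣≡∣X[Y─X]∣*∣X∣ :
        ∣ prod G (prod G X (Y ─ X)) X ∣ * ∣ X ∩ Y ∣ ≡ ∣ prod G X (Y ─ X) ∣ * ∣ X ∣
      ∣X[Y─X]X∣*∣X∩Y∣≡∣X[Y─X]∣*∣X∣ = fibre-counting XD X (X ∩ Y) λ g∈XD c∈X → mk⇔
        (λ (gt∈XD , t⁻¹c∈X) → let t∈X = inv-∈⇒∈ X≤G (∈-cancelʳ X≤G c∈X t⁻¹c∈X) in
          x∈p∩q⁺ (t∈X , gt∈XD⇒t∈Y g∈XD t∈X gt∈XD))
        (λ t∈X∩Y → t∈X∩Y⇒gt∈XD g∈XD t∈X∩Y ,
          ∙-closed X≤G (inv-closed X≤G (proj₁ (x∈p∩q⁻ X Y t∈X∩Y))) c∈X)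

    H∩Y⊆X⇒H⊆∁X[Y─X]X : IsSubgroup G H → X ⊆ H → H ∩ Y ⊆ X → H ⊆ ∁ (prod G (prod G X (Y ─ X)) X)
    H∩Y⊆X⇒H⊆∁X[Y─X]X {H} H≤G X⊆H H∩Y⊆X {w} w∈H = x∉p⇒x∈∁p w∉XDX
      where
      w∉XDX : w ∉ prod G XD X
      w∉XDX w∈XDX with ∈-prod⁻ XD X w∈XDX
      ... | ad , a′ , ad∈XD , a′∈X , ada′≡w with ∈-prod⁻ X D ad∈XD
      ... | a , d , a∈X , d∈D , refl = x∈p─q⇒x∉q d∈D (H∩Y⊆X (x∈p∩q⁺ (d∈H , d∈Y d∈D)))
        where
        d∈H : d ∈ H
        d∈H = ∈-cancelˡ H≤G (X⊆H a∈X) (∈-cancelʳ H≤G (X⊆H a′∈X) (subst (_∈ H) (sym ada′≡w) w∈H))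

  module Orders (n k : ℕ) .{{_ : NonZero n}} .{{_ : NonZero k}} (N≡n³k : N ≡ n ^ 3 * k) where

    open +-*-Solver

    private
      instance
        n²k≢0 : NonZero (n ^ 2 * k)
        n²k≢0 = m*n≢0 (n ^ 2) k {{m^n≢0 n 2}}

        n³k≢0 : NonZero (n ^ 3 * k)
        n³k≢0 = m*n≢0 (n ^ 3) k {{m^n≢0 n 3}}

      n²k*x≡nk*nk⇒x≡k : ∀ {x} → n ^ 2 * k * x ≡ n * k * (n * k) → x ≡ k
      n²k*x≡nk*nk⇒x≡k {x} eq = *-cancelˡ-≡ x k (n ^ 2 * k) (trans eq
        (solve 2 (λ n k → n :* k :* (n :* k) := n :^ 2 :* k :* k) refl n k))

      N*x≡n²k*nk⇒x≡k : ∀ {x} → N * x ≡ n ^ 2 * k * (n * k) → x ≡ k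
      N*x≡n²k*nk⇒x≡k {x} eq = *-cancelˡ-≡ x k (n ^ 3 * k) (trans (cong (_* x) (sym N≡n³k)) (trans eq
        (solve 2 (λ n k → n :^ 2 :* k :* (n :* k) := n :^ 3 :* k :* k) refl n k)))

      N*x≡n²k*n²k⇒x≡nk : ∀ {x} → N * x ≡ n ^ 2 * k * (n ^ 2 * k) → x ≡ n * k
      N*x≡n²k*n²k⇒x≡nk {x} eq = *-cancelˡ-≡ x (n * k) (n ^ 3 * k) (trans (cong (_* x) (sym N≡n³k)) (trans eq
        (solve 2 (λ n k → n :^ 2 :* k :* (n :^ 2 :* k) := n :^ 3 :* k :* (n :* k)) refl n k)))

      x*k≡nk*d⇒x≡nd : ∀ {x d} → x * k ≡ n * k * d → x ≡ n * d
      x*k≡nk*d⇒x≡nd {x} {d} eq = *-cancelʳ-≡ x (n * d) k (trans eq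
        (solve 3 (λ n k d → n :* k :* d := n :* d :* k) refl n k d))

      x*k≡nd*nk⇒x≡nnd : ∀ {x d} → x * k ≡ n * d * (n * k) → x ≡ n * n * d
      x*k≡nd*nk⇒x≡nnd {x} {d} eq = *-cancelʳ-≡ x (n * n * d) k (trans eq
        (solve 3 (λ n k d → n :* d :* (n :* k) := n :* n :* d :* k) refl n k d))

      x+nnd≡N⇒x≡n²k : ∀ {x d} → d + k ≡ n * k → x + n * n * d ≡ N → x ≡ n ^ 2 * k
      x+nnd≡N⇒x≡n²k {x} {d} d+k≡nk eq = +-cancelʳ-≡ (n * n * d) x (n ^ 2 * k) (begin
        x + n * n * d               ≡⟨ trans eq N≡n³k ⟩
        n ^ 3 * k                   ≡⟨ solve 2 (λ n k → n :^ 3 :* k := n :* n :* (n :* k)) refl n k ⟩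
        n * n * (n * k)             ≡⟨ cong (n * n *_) d+k≡nk ⟨
        n * n * (d + k)             ≡⟨ solve 3 (λ n k d → n :* n :* (d :+ k) := n :^ 2 :* k :+ n :* n :* d) refl n k d ⟩
        n ^ 2 * k + n * n * d       ∎)
        where open ≡-Reasoning

    ∣X∩M∣≡k : IsSubgroup G X → IsSubgroup G M → ∣ prod G X M ∣ ≡ n ^ 2 * k
      → ∣ X ∣ ≡ n * k → ∣ M ∣ ≡ n * k → ∣ X ∩ M ∣ ≡ k
    ∣X∩M∣≡k {X} {M} X≤G M≤G ∣XM∣ ∣X∣ ∣M∣ = n²k*x≡nk*nk⇒x≡k (begin
      n ^ 2 * k * ∣ X ∩ M ∣          ≡⟨ cong (_* ∣ X ∩ M ∣) ∣XM∣ ⟨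
      ∣ prod G X M ∣ * ∣ X ∩ M ∣     ≡⟨ product-formula X≤G M≤G ⟩
      ∣ X ∣ * ∣ M ∣                  ≡⟨ cong₂ _*_ ∣X∣ ∣M∣ ⟩
      n * k * (n * k)                ∎)
      where open ≡-Reasoning

    H∩Y≡X∩Y : IsSubgroup G H → IsSubgroup G Y → X ⊆ H
      → ∣ H ∣ ≡ n ^ 2 * k → ∣ Y ∣ ≡ n * k → ∣ X ∩ Y ∣ ≡ k → prod G H Y ≡ ⊤
      → H ∩ Y ≡ X ∩ Y
    H∩Y≡X∩Y {H} {Y} {X} H≤G Y≤G X⊆H ∣H∣ ∣Y∣ ∣X∩Y∣ HY≡⊤ =
      sym (p⊆q∧∣q∣≤∣p∣⇒p≡q (X ∩ Y) (H ∩ Y) X∩Y⊆H∩Y (≤-reflexive (trans ∣H∩Y∣≡k (sym ∣X∩Y∣))))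
      where
      X∩Y⊆H∩Y : X ∩ Y ⊆ H ∩ Y
      X∩Y⊆H∩Y x∈X∩Y = let (x∈X , x∈Y) = x∈p∩q⁻ X Y x∈X∩Y in x∈p∩q⁺ (X⊆H x∈X , x∈Y)
      ∣H∩Y∣≡k : ∣ H ∩ Y ∣ ≡ k
      ∣H∩Y∣≡k = N*x≡n²k*nk⇒x≡k (trans (XY≡⊤⇒N*∣X∩Y∣≡∣X∣*∣Y∣ H≤G Y≤G HY≡⊤) (cong₂ _*_ ∣H∣ ∣Y∣))

    H∩K≡M : IsSubgroup G H → IsSubgroup G K → ∣ H ∣ ≡ n ^ 2 * k → ∣ K ∣ ≡ n ^ 2 * k → prod G H K ≡ ⊤
      → M ⊆ H ∩ K → ∣ M ∣ ≡ n * k → H ∩ K ≡ M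
    H∩K≡M {H} {K} {M} H≤G K≤G ∣H∣ ∣K∣ HK≡⊤ M⊆H∩K ∣M∣ =
      sym (p⊆q∧∣q∣≤∣p∣⇒p≡q M (H ∩ K) M⊆H∩K (≤-reflexive (trans ∣H∩K∣≡nk (sym ∣M∣))))
      where
      ∣H∩K∣≡nk : ∣ H ∩ K ∣ ≡ n * k
      ∣H∩K∣≡nk = N*x≡n²k*n²k⇒x≡nk (trans (XY≡⊤⇒N*∣X∩Y∣≡∣X∣*∣Y∣ H≤G K≤G HK≡⊤) (cong₂ _*_ ∣H∣ ∣K∣))

    H≡∁X[Y─X]X : IsSubgroup G X → IsSubgroup G Y → ∣ X ∣ ≡ n * k → ∣ Y ∣ ≡ n * k → ∣ X ∩ Y ∣ ≡ k
      → prod G X Y ∩ prod G Y X ⊆ X ∪ Y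
      → IsSubgroup G H → X ⊆ H → H ∩ Y ⊆ X → ∣ H ∣ ≡ n ^ 2 * k
      → H ≡ ∁ (prod G (prod G X (Y ─ X)) X)
    H≡∁X[Y─X]X {X} {Y} {H} X≤G Y≤G ∣X∣ ∣Y∣ ∣X∩Y∣ XY∩YX⊆X∪Y H≤G X⊆H H∩Y⊆X ∣H∣ =
      p⊆q∧∣q∣≤∣p∣⇒p≡q H (∁ S) (H∩Y⊆X⇒H⊆∁X[Y─X]X H≤G X⊆H H∩Y⊆X) (≤-reflexive (trans ∣∁S∣≡n²k (sym ∣H∣)))
      where
      open DoubleCosets X≤G Y≤G
      d = ∣ Y ─ X ∣
      XD = prod G X (Y ─ X)
      S = prod G XD X

      d+k≡nk : d + k ≡ n * k
      d+k≡nk = begin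
        d + k                  ≡⟨ cong (d +_) (trans (sym ∣X∩Y∣) (cong ∣_∣ (∩-comm X Y))) ⟩
        d + ∣ Y ∩ X ∣          ≡⟨ ∣p─q∣+∣p∩q∣≡∣p∣ Y X ⟩
        ∣ Y ∣                  ≡⟨ ∣Y∣ ⟩
        n * k                  ∎
        where open ≡-Reasoning

      ∣XD∣≡nd : ∣ XD ∣ ≡ n * d
      ∣XD∣≡nd = x*k≡nk*d⇒x≡nd (begin
        ∣ XD ∣ * k             ≡⟨ cong (∣ XD ∣ *_) ∣X∩Y∣ ⟨
        ∣ XD ∣ * ∣ X ∩ Y ∣     ≡⟨ ∣X[Y─X]∣*∣X∩Y∣≡∣X∣*∣Y─X∣ ⟩
        ∣ X ∣ * d              ≡⟨ cong (_* d) ∣X∣ ⟩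
        n * k * d              ∎)
        where open ≡-Reasoning

      ∣S∣≡nnd : ∣ S ∣ ≡ n * n * d
      ∣S∣≡nnd = x*k≡nd*nk⇒x≡nnd (begin
        ∣ S ∣ * k              ≡⟨ cong (∣ S ∣ *_) ∣X∩Y∣ ⟨
        ∣ S ∣ * ∣ X ∩ Y ∣      ≡⟨ ∣X[Y─X]X∣*∣X∩Y∣≡∣X[Y─X]∣*∣X∣ XY∩YX⊆X∪Y ⟩
        ∣ XD ∣ * ∣ X ∣         ≡⟨ cong₂ _*_ ∣XD∣≡nd ∣X∣ ⟩
        n * d * (n * k)        ∎)
        where open ≡-Reasoning

      ∣∁S∣≡n²k : ∣ ∁ S ∣ ≡ n ^ 2 * k
      ∣∁S∣≡n²k = x+nnd≡N⇒x≡n²k d+k≡nk (trans (cong (∣ ∁ S ∣ +_) (sym ∣S∣≡nnd)) (∣∁p∣+∣p∣≡n S))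

  X[Y─X]X⊆XYX : (X Y : Subset N) → prod G (prod G X (Y ─ X)) X ⊆ prod G (prod G X Y) X
  X[Y─X]X⊆XYX X Y = prod-mono {X = prod G X (Y ─ X)} {Y = X} (prod-mono {X = X} {Y = Y ─ X} id (p─q⊆p Y X)) id

  ∈-prod-assocˡ : a ∈ X → g ∈ prod G (prod G Y Z) W → a ∙ g ∈ prod G (prod G (prod G X Y) Z) W
  ∈-prod-assocˡ {a} {X} {Y = Y} {Z} {W} a∈X g∈YZW with ∈-prod⁻ (prod G Y Z) W g∈YZW
  ... | yz , w , yz∈YZ , w∈W , refl with ∈-prod⁻ Y Z yz∈YZ
  ... | y , z , y∈Y , z∈Z , refl = subst (_∈ prod G (prod G (prod G X Y) Z) W) a[[yz]w]≡[[ay]z]w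
    (∈-prod⁺ (∈-prod⁺ (∈-prod⁺ a∈X y∈Y) z∈Z) w∈W)
    where
    a[[yz]w]≡[[ay]z]w : ((a ∙ y) ∙ z) ∙ w ≡ a ∙ ((y ∙ z) ∙ w)
    a[[yz]w]≡[[ay]z]w = begin
      ((a ∙ y) ∙ z) ∙ w   ≡⟨ cong (_∙ w) (assoc a y z) ⟩
      (a ∙ (y ∙ z)) ∙ w   ≡⟨ assoc a (y ∙ z) w ⟩
      a ∙ ((y ∙ z) ∙ w)   ∎
      where open ≡-Reasoning

  ABAB≡⊤ : IsSubgroup G A → IsSubgroup G B → IsSubgroup G M
    → prod G A M ∩ prod G B M ≡ M
    → prod G A M ≡ ∁ (prod G (prod G A (B ─ A)) A)
    → prod G B M ≡ ∁ (prod G (prod G B (A ─ B)) B)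
    → Nonempty (A ─ M)
    → prod G (prod G (prod G A B) A) B ≡ ⊤
  ABAB≡⊤ {A} {B} {M} A≤G B≤G M≤G AM∩BM≡M AM≡∁A[B─A]A BM≡∁B[A─B]B (a , a∈A─M) = all∈⇒≡⊤ ∈ABAB
    where
    ABAB = prod G (prod G (prod G A B) A) B
    AM = prod G A M
    BM = prod G B M

    ABA⊆ABAB : prod G (prod G A B) A ⊆ ABAB
    ABA⊆ABAB = ⊆-prodˡ (e∈ B≤G)

    BAB⊆ABAB : prod G (prod G B A) B ⊆ ABAB
    BAB⊆ABAB = prod-mono {X = prod G B A} {Y = B} (prod-mono {X = B} {Y = A} (⊆-prodʳ (e∈ A≤G)) id) id

    g∉BM⇒g∈BAB : g ∉ BM → g ∈ prod G (prod G B A) B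
    g∉BM⇒g∈BAB = X[Y─X]X⊆XYX B A ∘ x∉∁p⇒x∈p ∘ subst (_ ∉_) BM≡∁B[A─B]B

    g∉AM⇒g∈ABA : g ∉ AM → g ∈ prod G (prod G A B) A
    g∉AM⇒g∈ABA = X[Y─X]X⊆XYX A B ∘ x∉∁p⇒x∈p ∘ subst (_ ∉_) AM≡∁A[B─A]A

    a∈A : a ∈ A
    a∈A = p─q⊆p A M a∈A─M

    a⁻¹g∉BM : g ∈ M → inv a ∙ g ∉ BM
    a⁻¹g∉BM {g} g∈M a⁻¹g∈BM = x∈p─q⇒x∉q a∈A─M
      (inv-∈⇒∈ M≤G (∈-cancelʳ M≤G g∈M (subst (_ ∈_) AM∩BM≡M (x∈p∩q⁺ (∈-prod⁺ (inv-closed A≤G a∈A) g∈M , a⁻¹g∈BM)))))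

    ∈ABAB : ∀ g → g ∈ ABAB
    ∈ABAB g with g ∈? BM | g ∈? AM
    ... | no g∉BM   | _         = BAB⊆ABAB (g∉BM⇒g∈BAB g∉BM)
    ... | yes _     | no g∉AM   = ABA⊆ABAB (g∉AM⇒g∈ABA g∉AM)
    ... | yes g∈BM | yes g∈AM =
      subst (_∈ ABAB) (\\-leftDividesˡ a g) (∈-prod-assocˡ {Y = B} {Z = A} {W = B} a∈A (g∉BM⇒g∈BAB (a⁻¹g∉BM g∈M)))
      where
      g∈M : g ∈ M
      g∈M = subst (_ ∈_) AM∩BM≡M (x∈p∩q⁺ (g∈AM , g∈BM))

  ABAB≡⊤⇒GeneratedBy : prod G (prod G (prod G A B) A) B ≡ ⊤ → GeneratedBy G A B
  ABAB≡⊤⇒GeneratedBy ABAB≡⊤ H H≤G A⊆H B⊆H = all∈⇒≡⊤ λ g →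
    prod-⊆-subgroup H≤G (prod-⊆-subgroup H≤G (prod-⊆-subgroup H≤G A⊆H B⊆H) A⊆H) B⊆H
      (subst (g ∈_) (sym ABAB≡⊤) ∈⊤)

  module TripleFactorisation (n : ℕ) (1<n : 1 < n) (A B : Subset N) (A≤G : IsSubgroup G A) (B≤G : IsSubgroup G B)
    (∣A∣ : ∣ A ∣ ≡ n * ∣ A ∩ B ∣) (∣B∣ : ∣ B ∣ ≡ n * ∣ A ∩ B ∣) (N≡n³k : N ≡ n ^ 3 * ∣ A ∩ B ∣)
    (AB∩BA≡A∪B : prod G A B ∩ prod G B A ≡ A ∪ B) where

    k = ∣ A ∩ B ∣

    private
      instance
        n≢0 : NonZero n
        n≢0 = >-nonZero (m<n⇒0<n 1<n)

        k≢0 : NonZero k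
        k≢0 = x∈p⇒∣p∣≢0 (x∈p∩q⁺ (e∈ A≤G , e∈ B≤G))

      ∣B∩A∣ : ∣ B ∩ A ∣ ≡ k
      ∣B∩A∣ = cong ∣_∣ (∩-comm B A)

      AB∩BA⊆A∪B : prod G A B ∩ prod G B A ⊆ A ∪ B
      AB∩BA⊆A∪B = subst (prod G A B ∩ prod G B A ⊆_) AB∩BA≡A∪B id

      BA∩AB⊆B∪A : prod G B A ∩ prod G A B ⊆ B ∪ A
      BA∩AB⊆B∪A = subst₂ _⊆_ (∩-comm (prod G A B) (prod G B A)) (∪-comm A B) AB∩BA⊆A∪B

    open Orders n k N≡n³k

    record IsMiddleFactor (M : Subset N) : Set where
      field
        M≤G   : IsSubgroup G M
        ∣M∣   : ∣ M ∣ ≡ n * k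
        AM≤G  : IsSubgroup G (prod G A M)
        BM≤G  : IsSubgroup G (prod G B M)
        ∣AM∣  : ∣ prod G A M ∣ ≡ n ^ 2 * k
        ∣BM∣  : ∣ prod G B M ∣ ≡ n ^ 2 * k
        AMB≡G : prod G (prod G A M) B ≡ ⊤

    module MiddleFactor {M : Subset N} (M-mid : IsMiddleFactor M) where

      open IsMiddleFactor M-mid

      private
        AM = prod G A M
        BM = prod G B M

        e∈M : e ∈ M
        e∈M = e∈ M≤G

        BMA≡G : prod G BM A ≡ ⊤
        BMA≡G = XYZ≡⊤⇒ZYX≡⊤ A≤G M≤G B≤G AMB≡G

        AMBM≡G : prod G AM BM ≡ ⊤
        AMBM≡G = all∈⇒≡⊤ λ g → prod-mono {X = AM} {Y = B} id (⊆-prodˡ e∈M) (subst (g ∈_) (sym AMB≡G) ∈⊤)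

      AM∩B≡A∩B : AM ∩ B ≡ A ∩ B
      AM∩B≡A∩B = H∩Y≡X∩Y AM≤G B≤G (⊆-prodˡ e∈M) ∣AM∣ ∣B∣ refl AMB≡G

      A∩B≡BM∩A : A ∩ B ≡ BM ∩ A
      A∩B≡BM∩A = trans (∩-comm A B) (sym (H∩Y≡X∩Y BM≤G A≤G (⊆-prodˡ e∈M) ∣BM∣ ∣A∣ ∣B∩A∣ BMA≡G))

      A∩M≡A∩B : A ∩ M ≡ A ∩ B
      A∩M≡A∩B = p⊆q∧∣q∣≤∣p∣⇒p≡q (A ∩ M) (A ∩ B) A∩M⊆A∩B (≤-reflexive (sym (∣X∩M∣≡k A≤G M≤G ∣AM∣ ∣A∣ ∣M∣)))
        where
        A∩M⊆A∩B : A ∩ M ⊆ A ∩ B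
        A∩M⊆A∩B x∈A∩M = let (x∈A , x∈M) = x∈p∩q⁻ A M x∈A∩M in
          subst (_ ∈_) (sym A∩B≡BM∩A) (x∈p∩q⁺ (⊆-prodʳ (e∈ B≤G) x∈M , x∈A))

      A∩B≡B∩M : A ∩ B ≡ B ∩ M
      A∩B≡B∩M = sym (p⊆q∧∣q∣≤∣p∣⇒p≡q (B ∩ M) (A ∩ B) B∩M⊆A∩B (≤-reflexive (sym (∣X∩M∣≡k B≤G M≤G ∣BM∣ ∣B∣ ∣M∣))))
        where
        B∩M⊆A∩B : B ∩ M ⊆ A ∩ B
        B∩M⊆A∩B x∈B∩M = let (x∈B , x∈M) = x∈p∩q⁻ B M x∈B∩M in
          subst (_ ∈_) AM∩B≡A∩B (x∈p∩q⁺ (⊆-prodʳ (e∈ A≤G) x∈M , x∈B))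

      AM∩BM≡M : AM ∩ BM ≡ M
      AM∩BM≡M = H∩K≡M AM≤G BM≤G ∣AM∣ ∣BM∣ AMBM≡G
        (λ x∈M → x∈p∩q⁺ (⊆-prodʳ (e∈ A≤G) x∈M , ⊆-prodʳ (e∈ B≤G) x∈M)) ∣M∣

      AM≡∁A[B─A]A : AM ≡ ∁ (prod G (prod G A (B ─ A)) A)
      AM≡∁A[B─A]A = H≡∁X[Y─X]X A≤G B≤G ∣A∣ ∣B∣ refl AB∩BA⊆A∪B AM≤G (⊆-prodˡ e∈M)
        (proj₁ ∘ x∈p∩q⁻ A B ∘ subst (_ ∈_) AM∩B≡A∩B) ∣AM∣

      BM≡∁B[A─B]B : BM ≡ ∁ (prod G (prod G B (A ─ B)) B)
      BM≡∁B[A─B]B = H≡∁X[Y─X]X B≤G A≤G ∣B∣ ∣A∣ ∣B∩A∣ BA∩AB⊆B∪A BM≤G (⊆-prodˡ e∈M)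
        (proj₂ ∘ x∈p∩q⁻ A B ∘ subst (_ ∈_) (sym A∩B≡BM∩A)) ∣BM∣

      ABAB≡G : prod G (prod G (prod G A B) A) B ≡ ⊤
      ABAB≡G = ABAB≡⊤ A≤G B≤G M≤G AM∩BM≡M AM≡∁A[B─A]A BM≡∁B[A─B]B (∣p∩q∣<∣p∣⇒Nonempty[p─q] ∣A∩M∣<∣A∣)
        where
        ∣A∩M∣<∣A∣ : ∣ A ∩ M ∣ < ∣ A ∣
        ∣A∩M∣<∣A∣ = subst₂ _<_ (sym (∣X∩M∣≡k A≤G M≤G ∣AM∣ ∣A∣ ∣M∣)) (trans (*-comm k n) (sym ∣A∣)) (m<m*n k n 1<n)

    middle-factor-unique : ∀ {M M′} → IsMiddleFactor M → IsMiddleFactor M′ → M′ ≡ M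
    middle-factor-unique {M} {M′} M-mid M′-mid = begin
      M′                           ≡⟨ M′.AM∩BM≡M ⟨
      prod G A M′ ∩ prod G B M′    ≡⟨ cong₂ _∩_ (trans M′.AM≡∁A[B─A]A (sym M.AM≡∁A[B─A]A))
                                                (trans M′.BM≡∁B[A─B]B (sym M.BM≡∁B[A─B]B)) ⟩
      prod G A M ∩ prod G B M      ≡⟨ M.AM∩BM≡M ⟩
      M                            ∎
      where
      open ≡-Reasoning
      module M  = MiddleFactor M-mid
      module M′ = MiddleFactor M′-mid

corollary2p8 : (n N : ℕ) (G : FinGroup N) (A B M : Subset N)
  → n > 1
  → IsSubgroup G A → IsSubgroup G B → IsSubgroup G M
  → ∣ A ∣ ≡ n * ∣ A ∩ B ∣ → ∣ B ∣ ≡ n * ∣ A ∩ B ∣ → ∣ M ∣ ≡ n * ∣ A ∩ B ∣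
  → N ≡ n ^ 3 * ∣ A ∩ B ∣
  → IsSubgroup G (prod G A M) → IsSubgroup G (prod G B M)
  → ∣ prod G A M ∣ ≡ n ^ 2 * ∣ A ∩ B ∣ → ∣ prod G B M ∣ ≡ n ^ 2 * ∣ A ∩ B ∣
  → prod G (prod G A M) B ≡ ⊤
  → prod G A B ∩ prod G B A ≡ A ∪ B
  → ((A ∩ M ≡ A ∩ B) × (A ∩ B ≡ B ∩ M))
  × ((prod G A M ∩ B ≡ A ∩ B) × (A ∩ B ≡ prod G B M ∩ A))
  × (prod G A M ∩ prod G B M ≡ M)
  × ((prod G A M ≡ ∁ (prod G (prod G A (B ─ A)) A))
     × (prod G B M ≡ ∁ (prod G (prod G B (A ─ B)) B)))
  × ((prod G (prod G (prod G A B) A) B ≡ ⊤) × GeneratedBy G A B)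
  × (∀ (M′ : Subset N) → IsSubgroup G M′
     → ∣ M′ ∣ ≡ n * ∣ A ∩ B ∣
     → IsSubgroup G (prod G A M′) → IsSubgroup G (prod G B M′)
     → ∣ prod G A M′ ∣ ≡ n ^ 2 * ∣ A ∩ B ∣ → ∣ prod G B M′ ∣ ≡ n ^ 2 * ∣ A ∩ B ∣
     → prod G (prod G A M′) B ≡ ⊤
     → M′ ≡ M)
corollary2p8 n N G A B M 1<n A≤G B≤G M≤G ∣A∣ ∣B∣ ∣M∣ N≡n³k AM≤G BM≤G ∣AM∣ ∣BM∣ AMB≡G AB∩BA≡A∪B =
  (A∩M≡A∩B , A∩B≡B∩M) , (AM∩B≡A∩B , A∩B≡BM∩A) , AM∩BM≡M , (AM≡∁A[B─A]A , BM≡∁B[A─B]B) ,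
  (ABAB≡G , ABAB≡⊤⇒GeneratedBy G ABAB≡G) ,
  λ M′ M′≤G ∣M′∣ AM′≤G BM′≤G ∣AM′∣ ∣BM′∣ AM′B≡G →
    middle-factor-unique M-mid (record { M≤G = M′≤G ; ∣M∣ = ∣M′∣ ; AM≤G = AM′≤G ; BM≤G = BM′≤G
                                       ; ∣AM∣ = ∣AM′∣ ; ∣BM∣ = ∣BM′∣ ; AMB≡G = AM′B≡G })
  where
  open TripleFactorisation G n 1<n A B A≤G B≤G ∣A∣ ∣B∣ N≡n³k AB∩BA≡A∪B

  M-mid : IsMiddleFactor M
  M-mid = record { M≤G = M≤G ; ∣M∣ = ∣M∣ ; AM≤G = AM≤G ; BM≤G = BM≤G
                 ; ∣AM∣ = ∣AM∣ ; ∣BM∣ = ∣BM∣ ; AMB≡G = AMB≡G }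

  open MiddleFactor M-mid
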